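{- Let $k>2$, $m>1$ and $i$ be positive integers with $i\mid m$. Then \[ r_\mathcal{M}(i,m,k)=\sum_{l\mid i} l\,\varphi(m/l)\,r_\mathcal{M}(l,m,k-1), \] where the sum runs over positive divisors $l$ of $i$ and $\varphi$ is Euler's totient function.
   Context: $\mathbb{N}=\{0,1,2,\ldots\}$. Let $\mathcal{M}=(m^{j-1})_{j\in\mathbb{N}_+}$ and let $p_\mathcal{M}(n,k)$ be the number of tuples $(x_1,\ldots,x_k)\in\mathbb{N}^k$ with $x_1+mx_2+\cdots+m^{k-1}x_k=n$. For integers $k\ge1$ and any integer $i$, define $r_\mathcal{M}(i,m,k)=\#\{n\in\{0,1,\ldots,m^k-1\}:\ p_\mathcal{M}(n,k)\equiv i\pmod{m}\}$. -}

module Defs where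

open import Data.Nat using (ℕ; zero; suc; _+_; _*_; _∸_; _^_; _≟_; NonZero)
open import Data.Nat.DivMod using (_%_; _/_)
open import Data.Nat.GCD using (gcd)
open import Data.Nat.Divisibility using (_∣?_)
open import Data.List using (List; []; _∷_; length; filter; map; upTo; concatMap)
open import Data.Nat.ListAction using (sum)
open import Data.Vec using (Vec; []; _∷_)

tuples : (k n : ℕ) → List (Vec ℕ k)
tuples zero    n = [] ∷ []
tuples (suc k) n = concatMap (λ x → map (x ∷_) (tuples k n)) (upTo (suc n))

weighted : (m : ℕ) {k : ℕ} → Vec ℕ k → ℕ
weighted m []       = 0
weighted m (x ∷ xs) = x + m * weighted m xs

-- p_M(n,k) : number of (x₁,…,x_k) ∈ ℕ^k with x₁ + m x₂ + ⋯ + m^{k-1} x_k = n.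
-- (For m ≥ 1 every such x_j is ≤ n, so enumerating {0,…,n}^k is exhaustive.)
pM : (m n k : ℕ) → ℕ
pM m n k = length (filter (λ v → weighted m v ≟ n) (tuples k n))

rM : (i m k : ℕ) → .{{NonZero m}} → ℕ
rM i m k = length (filter (λ n → pM m n k % m ≟ i % m) (upTo (m ^ k)))

φ : ℕ → ℕ
φ n = length (filter (λ a → gcd a n ≟ 1) (map suc (upTo n)))

sumDivisors : (i : ℕ) → ((l : ℕ) → .{{NonZero l}} → ℕ) → ℕ
sumDivisors i f = sum (map (λ j → f (suc j)) (filter (λ j → suc j ∣? i) (upTo i)))

{-# OPTIONS --safe #-}
-- Put p≤ k q = Σ_{j ≤ q} p(j,k).  Since p(n,k+1) = Σ_{mj ≤ n} p(j,k), we get p(t + mq, k+1) = p≤ k q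
-- for t < m, and p≤ (k+1) (s + mb) ≡ (s+1) · p≤ k b (mod m).  So p(·,k+2) runs through the residues
-- (s+1) · p≤ k q (s < m, q < m^k), each m times, and r(i,m,k+2) = m Σ_q N(p≤ k q, i), where
-- N(x,y) = #{t < m : t x ≡ y (mod m)} = gcd(x,m) · [gcd(x,m) ∣ y].  One level higher,
-- r(i,m,k+3) = m Σ_q Σ_{c<m} N(p≤ k q, c) N(c, i).  The summand depends on c only through
-- l = gcd(c,m), vanishes unless l ∣ i, and l is attained by φ(m/l) residues c; this turns the inner
-- sum into Σ_{l ∣ i} l φ(m/l) N(p≤ k q, l), i.e. the right-hand side.

module Submission where

open import Defs
open import Data.Empty using (⊥-elim)
open import Data.List using (List; []; _∷_; _++_; length; filter; map; concatMap; applyUpTo; upTo)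
open import Data.List.Properties using (map-++; map-∘)
open import Data.Nat
open import Data.Nat.Coprimality as Coprimality using (Coprime; coprime-divisor; coprime-/gcd)
open import Data.Nat.Divisibility
open import Data.Nat.DivMod
open import Data.Nat.GCD
open import Data.Nat.ListAction using (sum)
open import Data.Nat.ListAction.Properties using (sum-++)
open import Data.Nat.Properties
open import Algebra.Properties.CommutativeSemigroup +-commutativeSemigroup using (interchange)
open import Data.Nat.Tactic.RingSolver using (solve-∀)
open import Data.Product using (_×_; _,_)
open import Data.Sum using (inj₂)
open import Data.Vec using (Vec) renaming (_∷_ to _∷ᵛ_)
open import Function using (_∘_)
open import Relation.Binary.PropositionalEquality
open import Relation.Nullary using (Dec; yes; no; ¬_; contradiction)
open import Relation.Unary using (Pred; Decidable)
open ≡-Reasoning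

-- Finite sums and indicators

∑ : ℕ → (ℕ → ℕ) → ℕ
∑ zero    f = 0
∑ (suc n) f = f 0 + ∑ n (f ∘ suc)

𝟙 : ∀ {p} {P : Set p} → Dec P → ℕ
𝟙 (yes _) = 1
𝟙 (no _)  = 0

𝟙-yes : ∀ {p} {P : Set p} (P? : Dec P) → P → 𝟙 P? ≡ 1
𝟙-yes (yes _) _  = refl
𝟙-yes (no ¬p) p = ⊥-elim (¬p p)

𝟙-no : ∀ {p} {P : Set p} (P? : Dec P) → ¬ P → 𝟙 P? ≡ 0
𝟙-no (yes p) ¬p = ⊥-elim (¬p p)
𝟙-no (no _)  _  = refl

𝟙-cong : ∀ {p q} {P : Set p} {Q : Set q} (P? : Dec P) (Q? : Dec Q) → (P → Q) → (Q → P) → 𝟙 P? ≡ 𝟙 Q?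
𝟙-cong (yes _) (yes _) _ _ = refl
𝟙-cong (yes p) (no ¬q) f _ = ⊥-elim (¬q (f p))
𝟙-cong (no ¬p) (yes q) _ g = ⊥-elim (¬p (g q))
𝟙-cong (no _)  (no _)  _ _ = refl

𝟙-≟-sym : ∀ a b → 𝟙 (a ≟ b) ≡ 𝟙 (b ≟ a)
𝟙-≟-sym a b = 𝟙-cong (a ≟ b) (b ≟ a) sym sym

∑-cong : ∀ n {f g} → (∀ t → t < n → f t ≡ g t) → ∑ n f ≡ ∑ n g
∑-cong zero    _   = refl
∑-cong (suc n) f≗g = cong₂ _+_ (f≗g 0 z<s) (∑-cong n (λ t t<n → f≗g (suc t) (s<s t<n)))

∑-zero : ∀ n {f} → (∀ t → t < n → f t ≡ 0) → ∑ n f ≡ 0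
∑-zero zero    _   = refl
∑-zero (suc n) f≗0 = cong₂ _+_ (f≗0 0 z<s) (∑-zero n (λ t t<n → f≗0 (suc t) (s<s t<n)))

∑-const : ∀ n c → ∑ n (λ _ → c) ≡ n * c
∑-const zero    c = refl
∑-const (suc n) c = cong (c +_) (∑-const n c)

∑-distrib-+ : ∀ n f g → ∑ n (λ t → f t + g t) ≡ ∑ n f + ∑ n g
∑-distrib-+ zero    f g = refl
∑-distrib-+ (suc n) f g = begin
  f 0 + g 0 + ∑ n (λ t → f (suc t) + g (suc t)) ≡⟨ cong (f 0 + g 0 +_) (∑-distrib-+ n (f ∘ suc) (g ∘ suc)) ⟩
  f 0 + g 0 + (∑ n (f ∘ suc) + ∑ n (g ∘ suc))   ≡⟨ interchange (f 0) (g 0) _ _ ⟩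
  f 0 + ∑ n (f ∘ suc) + (g 0 + ∑ n (g ∘ suc))   ∎

∑-*ˡ : ∀ n c f → ∑ n (λ t → c * f t) ≡ c * ∑ n f
∑-*ˡ zero    c f = sym (*-zeroʳ c)
∑-*ˡ (suc n) c f = trans (cong (c * f 0 +_) (∑-*ˡ n c (f ∘ suc))) (sym (*-distribˡ-+ c (f 0) _))

∑-*ʳ : ∀ n c f → ∑ n (λ t → f t * c) ≡ ∑ n f * c
∑-*ʳ n c f = trans (∑-cong n (λ t _ → *-comm (f t) c)) (trans (∑-*ˡ n c f) (*-comm c _))

∑-comm : ∀ n k (f : ℕ → ℕ → ℕ) → ∑ n (λ a → ∑ k (f a)) ≡ ∑ k (λ b → ∑ n (λ a → f a b))
∑-comm zero    k f = sym (∑-zero k (λ _ _ → refl))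
∑-comm (suc n) k f = begin
  ∑ k (f 0) + ∑ n (λ a → ∑ k (f (suc a)))        ≡⟨ cong (∑ k (f 0) +_) (∑-comm n k (f ∘ suc)) ⟩
  ∑ k (f 0) + ∑ k (λ b → ∑ n (λ a → f (suc a) b)) ≡⟨ sym (∑-distrib-+ k (f 0) _) ⟩
  ∑ k (λ b → f 0 b + ∑ n (λ a → f (suc a) b))     ∎

∑-split : ∀ a b f → ∑ (a + b) f ≡ ∑ a f + ∑ b (λ t → f (a + t))
∑-split zero    b f = refl
∑-split (suc a) b f = trans (cong (f 0 +_) (∑-split a b (f ∘ suc))) (sym (+-assoc (f 0) _ _))

∑-blocks : ∀ m N f → ∑ (m * N) f ≡ ∑ N (λ a → ∑ m (λ t → f (t + m * a)))
∑-blocks m zero    f = cong (λ n → ∑ n f) (*-zeroʳ m)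
∑-blocks m (suc N) f = begin
  ∑ (m * suc N) f                                       ≡⟨ cong (λ n → ∑ n f) (*-suc m N) ⟩
  ∑ (m + m * N) f                                       ≡⟨ ∑-split m (m * N) f ⟩
  ∑ m f + ∑ (m * N) (λ u → f (m + u))                   ≡⟨ cong₂ _+_ (∑-cong m (λ t _ → cong f t≡t+m*0))
                                                                      (∑-blocks m N (λ u → f (m + u))) ⟩
  ∑ m (λ t → f (t + m * 0)) + ∑ N (λ a → ∑ m (λ t → f (m + (t + m * a))))
                                                        ≡⟨ cong (_ +_) (∑-cong N (λ a _ → ∑-cong m (λ t _ → cong f (shift t a)))) ⟩
  ∑ m (λ t → f (t + m * 0)) + ∑ N (λ a → ∑ m (λ t → f (t + m * suc a))) ∎
  where
  t≡t+m*0 : ∀ {t} → t ≡ t + m * 0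
  t≡t+m*0 {t} = sym (trans (cong (t +_) (*-zeroʳ m)) (+-identityʳ t))
  shift : ∀ t a → m + (t + m * a) ≡ t + m * suc a
  shift t a = begin
    m + (t + m * a) ≡⟨ sym (+-assoc m t _) ⟩
    m + t + m * a   ≡⟨ cong (_+ m * a) (+-comm m t) ⟩
    t + m + m * a   ≡⟨ +-assoc t m _ ⟩
    t + (m + m * a) ≡⟨ cong (t +_) (sym (*-suc m a)) ⟩
    t + m * suc a   ∎

∑-last : ∀ n f → ∑ (suc n) f ≡ ∑ n f + f n
∑-last zero    f = +-comm (f 0) 0
∑-last (suc n) f = trans (cong (f 0 +_) (∑-last n (f ∘ suc))) (sym (+-assoc (f 0) _ _))

∑-rotate : ∀ n f → f n ≡ f 0 → ∑ n (f ∘ suc) ≡ ∑ n f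
∑-rotate n f fn≡f0 = +-cancelʳ-≡ _ _ _ (begin
  ∑ n (f ∘ suc) + f 0 ≡⟨ +-comm _ (f 0) ⟩
  ∑ (suc n) f         ≡⟨ ∑-last n f ⟩
  ∑ n f + f n         ≡⟨ cong (∑ n f +_) fn≡f0 ⟩
  ∑ n f + f 0         ∎)

∑-truncate : ∀ {N N'} f → N ≤ N' → (∀ j → N ≤ j → j < N' → f j ≡ 0) → ∑ N' f ≡ ∑ N f
∑-truncate {N} {N'} f N≤N' vanish = begin
  ∑ N' f                                  ≡⟨ cong (λ n → ∑ n f) (sym (m+[n∸m]≡n N≤N')) ⟩
  ∑ (N + (N' ∸ N)) f                      ≡⟨ ∑-split N (N' ∸ N) f ⟩
  ∑ N f + ∑ (N' ∸ N) (λ t → f (N + t))    ≡⟨ cong (∑ N f +_) (∑-zero (N' ∸ N) (λ t t< → vanish (N + t) (m≤m+n N t) (bound t t<))) ⟩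
  ∑ N f + 0                               ≡⟨ +-identityʳ _ ⟩
  ∑ N f                                   ∎
  where
  bound : ∀ t → t < N' ∸ N → N + t < N'
  bound t t< = subst (N + t <_) (m+[n∸m]≡n N≤N') (+-monoʳ-< N t<)

∑-pick : ∀ n a (H : ℕ → ℕ) → a < n → ∑ n (λ c → 𝟙 (a ≟ c) * H c) ≡ H a
∑-pick (suc n) zero    H _ = begin
  H 0 + 0 + ∑ n (λ c → 0 * H (suc c)) ≡⟨ cong (H 0 + 0 +_) (∑-zero n (λ _ _ → refl)) ⟩
  H 0 + 0 + 0                         ≡⟨ trans (+-identityʳ _) (+-identityʳ _) ⟩
  H 0                                 ∎
∑-pick (suc n) (suc a) H a<n = trans
  (∑-cong n (λ c _ → cong (_* H (suc c)) (𝟙-cong (suc a ≟ suc c) (a ≟ c) suc-injective (cong suc))))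
  (∑-pick n a (H ∘ suc) (s<s⁻¹ a<n))

∑-fibers : ∀ N M (key H : ℕ → ℕ) → (∀ t → t < N → key t < M) →
           ∑ N (λ t → H (key t)) ≡ ∑ M (λ c → ∑ N (λ t → 𝟙 (key t ≟ c)) * H c)
∑-fibers N M key H key<M = begin
  ∑ N (λ t → H (key t))                              ≡⟨ ∑-cong N (λ t t<N → sym (∑-pick M (key t) H (key<M t t<N))) ⟩
  ∑ N (λ t → ∑ M (λ c → 𝟙 (key t ≟ c) * H c))       ≡⟨ ∑-comm N M _ ⟩
  ∑ M (λ c → ∑ N (λ t → 𝟙 (key t ≟ c) * H c))       ≡⟨ ∑-cong M (λ c _ → ∑-*ʳ N (H c) _) ⟩
  ∑ M (λ c → ∑ N (λ t → 𝟙 (key t ≟ c)) * H c)       ∎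

∑-𝟙-unique : ∀ n {p} {P : Pred ℕ p} (P? : Decidable P) →
             (∀ a b → a < n → b < n → P a → P b → a ≡ b) → ∑ n (λ t → 𝟙 (P? t)) ≤ 1
∑-𝟙-unique zero    P? unique = z≤n
∑-𝟙-unique (suc n) P? unique with P? 0
... | yes P0 = ≤-reflexive (cong suc (∑-zero n (λ t t<n → 𝟙-no (P? (suc t)) (λ Pt → 0≢1+n (unique 0 (suc t) z<s (s<s t<n) P0 Pt)))))
... | no _   = ∑-𝟙-unique n (P? ∘ suc) (λ a b a<n b<n Pa Pb → suc-injective (unique (suc a) (suc b) (s<s a<n) (s<s b<n) Pa Pb))

∑-saturated : ∀ n {f} → (∀ t → t < n → f t ≤ 1) → ∑ n f ≡ n → ∀ t → t < n → f t ≡ 1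
∑-saturated (suc n) {f} f≤1 sum≡n t t<n with split (f≤1 0 z<s) (∑≤n n (λ t t<n → f≤1 (suc t) (s<s t<n))) sum≡n
  where
  ∑≤n : ∀ n {g} → (∀ t → t < n → g t ≤ 1) → ∑ n g ≤ n
  ∑≤n zero    _   = z≤n
  ∑≤n (suc n) g≤1 = +-mono-≤ (g≤1 0 z<s) (∑≤n n (λ t t<n → g≤1 (suc t) (s<s t<n)))
  split : ∀ {a b} → a ≤ 1 → b ≤ n → a + b ≡ suc n → a ≡ 1 × b ≡ n
  split z≤n       b≤n refl = ⊥-elim (1+n≰n b≤n)
  split (s≤s z≤n) _   eq   = refl , suc-injective eq
... | f0≡1 , rest≡n with t
...   | zero  = f0≡1
...   | suc t = ∑-saturated n (λ t t<n → f≤1 (suc t) (s<s t<n)) rest≡n t (s<s⁻¹ t<n)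

∑-shift : ∀ N a f → (∀ n → N ≤ n → f n ≡ 0) → ∑ N (λ x → f (x + a)) ≡ ∑ N (λ n → 𝟙 (a ≤? n) * f n)
∑-shift N a f vanish = sym (begin
  ∑ N g
    ≡⟨ sym (∑-truncate g (m≤n+m N a) (λ j N≤j _ → trans (cong (𝟙 (a ≤? j) *_) (vanish j N≤j)) (*-zeroʳ (𝟙 (a ≤? j))))) ⟩
  ∑ (a + N) g
    ≡⟨ ∑-split a N g ⟩
  ∑ a g + ∑ N (λ t → g (a + t))
    ≡⟨ cong₂ _+_ (∑-zero a (λ j j<a → cong (_* f j) (𝟙-no (a ≤? j) (<⇒≱ j<a))))
                 (∑-cong N (λ t _ → trans (cong (_* f (a + t)) (𝟙-yes (a ≤? a + t) (m≤m+n a t))) (+-identityʳ _))) ⟩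
  0 + ∑ N (λ t → f (a + t))
    ≡⟨ ∑-cong N (λ t _ → cong f (+-comm a t)) ⟩
  ∑ N (λ x → f (x + a)) ∎)
  where
  g : ℕ → ℕ
  g n = 𝟙 (a ≤? n) * f n

∑-*-∑-comm : ∀ N M (a : ℕ → ℕ) (g : ℕ → ℕ → ℕ) (f : ℕ → ℕ) →
             ∑ N (λ j → a j * ∑ M (λ n → g j n * f n)) ≡ ∑ M (λ n → ∑ N (λ j → g j n * a j) * f n)
∑-*-∑-comm N M a g f = begin
  ∑ N (λ j → a j * ∑ M (λ n → g j n * f n))     ≡⟨ ∑-cong N (λ j _ → sym (∑-*ˡ M (a j) _)) ⟩
  ∑ N (λ j → ∑ M (λ n → a j * (g j n * f n)))   ≡⟨ ∑-comm N M _ ⟩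
  ∑ M (λ n → ∑ N (λ j → a j * (g j n * f n)))
    ≡⟨ ∑-cong M (λ n _ → trans (∑-cong N (λ j _ → reassoc (a j) (g j n) (f n))) (∑-*ʳ N (f n) _)) ⟩
  ∑ M (λ n → ∑ N (λ j → g j n * a j) * f n)     ∎
  where
  reassoc : ∀ x y z → x * (y * z) ≡ y * x * z
  reassoc x y z = trans (sym (*-assoc x y z)) (cong (_* z) (*-comm x y))

*-∑-∑-comm : ∀ c N n (a b : ℕ → ℕ) (f : ℕ → ℕ → ℕ) →
             c * ∑ N (λ q → ∑ n (λ j → a j * (b j * f q j))) ≡ ∑ n (λ j → a j * (b j * (c * ∑ N (λ q → f q j))))
*-∑-∑-comm c N n a b f = begin
  c * ∑ N (λ q → ∑ n (λ j → a j * (b j * f q j)))    ≡⟨ cong (c *_) (∑-comm N n _) ⟩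
  c * ∑ n (λ j → ∑ N (λ q → a j * (b j * f q j)))    ≡⟨ sym (∑-*ˡ n c _) ⟩
  ∑ n (λ j → c * ∑ N (λ q → a j * (b j * f q j)))    ≡⟨ ∑-cong n (λ j _ → pull j) ⟩
  ∑ n (λ j → a j * (b j * (c * ∑ N (λ q → f q j))))  ∎
  where
  pull : ∀ j → c * ∑ N (λ q → a j * (b j * f q j)) ≡ a j * (b j * (c * ∑ N (λ q → f q j)))
  pull j = begin
    c * ∑ N (λ q → a j * (b j * f q j))  ≡⟨ cong (c *_) (trans (∑-*ˡ N (a j) _) (cong (a j *_) (∑-*ˡ N (b j) _))) ⟩
    c * (a j * (b j * ∑ N (λ q → f q j))) ≡⟨ rotate c (a j) (b j) _ ⟩
    a j * (b j * (c * ∑ N (λ q → f q j))) ∎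
    where
    rotate : ∀ x y z w → x * (y * (z * w)) ≡ y * (z * (x * w))
    rotate = solve-∀

∑-𝟙-injective : ∀ n (f : ℕ → ℕ) → (∀ r → r < n → f r < n) → (∀ a b → a < n → b < n → f a ≡ f b → a ≡ b) →
                ∀ z → z < n → ∑ n (λ r → 𝟙 (f r ≟ z)) ≡ 1
∑-𝟙-injective n f f<n f-inj = ∑-saturated n fiber≤1 (begin
  ∑ n (λ z → ∑ n (λ r → 𝟙 (f r ≟ z)))     ≡⟨ ∑-comm n n (λ z r → 𝟙 (f r ≟ z)) ⟩
  ∑ n (λ r → ∑ n (λ z → 𝟙 (f r ≟ z)))     ≡⟨ ∑-cong n (λ r r<n → fiber-total r r<n) ⟩
  ∑ n (λ _ → 1)                            ≡⟨ trans (∑-const n 1) (*-identityʳ n) ⟩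
  n                                        ∎)
  where
  fiber≤1 : ∀ z → z < n → ∑ n (λ r → 𝟙 (f r ≟ z)) ≤ 1
  fiber≤1 z _ = ∑-𝟙-unique n (λ r → f r ≟ z) (λ a b a<n b<n fa≡z fb≡z → f-inj a b a<n b<n (trans fa≡z (sym fb≡z)))
  fiber-total : ∀ r → r < n → ∑ n (λ z → 𝟙 (f r ≟ z)) ≡ 1
  fiber-total r r<n = trans (∑-cong n (λ z _ → sym (*-identityʳ _))) (∑-pick n (f r) (λ _ → 1) (f<n r r<n))

module _ {a} {A : Set a} where

  length-filter : ∀ {p} {P : Pred A p} (P? : Decidable P) xs → length (filter P? xs) ≡ sum (map (λ x → 𝟙 (P? x)) xs)
  length-filter P? []       = refl
  length-filter P? (x ∷ xs) with P? x
  ... | yes _ = cong suc (length-filter P? xs)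
  ... | no _  = length-filter P? xs

  sum-map-filter : ∀ {p} {P : Pred A p} (P? : Decidable P) xs h →
                   sum (map h (filter P? xs)) ≡ sum (map (λ x → 𝟙 (P? x) * h x) xs)
  sum-map-filter P? []       h = refl
  sum-map-filter P? (x ∷ xs) h with P? x
  ... | yes _ = cong₂ _+_ (sym (+-identityʳ (h x))) (sum-map-filter P? xs h)
  ... | no _  = sum-map-filter P? xs h

  sum-map-map : ∀ {b} {B : Set b} (g : A → B) xs h → sum (map h (map g xs)) ≡ sum (map (h ∘ g) xs)
  sum-map-map g xs h = cong sum (sym (map-∘ xs))

  sum-map-cong : ∀ xs {f g : A → ℕ} → (∀ x → f x ≡ g x) → sum (map f xs) ≡ sum (map g xs)
  sum-map-cong []       f≗g = refl
  sum-map-cong (x ∷ xs) f≗g = cong₂ _+_ (f≗g x) (sum-map-cong xs f≗g)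

  sum-map-concatMap : ∀ {b} {B : Set b} (g : A → List B) xs h →
                      sum (map h (concatMap g xs)) ≡ sum (map (λ x → sum (map h (g x))) xs)
  sum-map-concatMap g []       h = refl
  sum-map-concatMap g (x ∷ xs) h = begin
    sum (map h (g x ++ concatMap g xs))                         ≡⟨ cong sum (map-++ h (g x) _) ⟩
    sum (map h (g x) ++ map h (concatMap g xs))                 ≡⟨ sum-++ (map h (g x)) _ ⟩
    sum (map h (g x)) + sum (map h (concatMap g xs))            ≡⟨ cong (sum (map h (g x)) +_) (sum-map-concatMap g xs h) ⟩
    sum (map h (g x)) + sum (map (λ x → sum (map h (g x))) xs)  ∎

sum-map-applyUpTo : ∀ f n (h : ℕ → ℕ) → sum (map h (applyUpTo f n)) ≡ ∑ n (h ∘ f)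
sum-map-applyUpTo f zero    h = refl
sum-map-applyUpTo f (suc n) h = cong (h (f 0) +_) (sum-map-applyUpTo (f ∘ suc) n h)

-- Counting solutions of linear congruences

%-≡⇒∣∸ : ∀ a b n .{{_ : NonZero n}} → a % n ≡ b % n → n ∣ a ∸ b
%-≡⇒∣∸ a b n eq = divides (a / n ∸ b / n) (begin
  a ∸ b                                     ≡⟨ cong₂ _∸_ (m≡m%n+[m/n]*n a n) (m≡m%n+[m/n]*n b n) ⟩
  (a % n + a / n * n) ∸ (b % n + b / n * n) ≡⟨ cong (λ r → (a % n + a / n * n) ∸ (r + b / n * n)) (sym eq) ⟩
  (a % n + a / n * n) ∸ (a % n + b / n * n) ≡⟨ [m+n]∸[m+o]≡n∸o (a % n) _ _ ⟩
  a / n * n ∸ b / n * n                     ≡⟨ sym (*-distribʳ-∸ n (a / n) (b / n)) ⟩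
  (a / n ∸ b / n) * n                       ∎)

∣∧<⇒≡0 : ∀ {n k} → n ∣ k → k < n → k ≡ 0
∣∧<⇒≡0 {k = zero}  _   _   = refl
∣∧<⇒≡0 {k = suc _} n∣k k<n = contradiction n∣k (>⇒∤ k<n)

*-cancelʳ-%-coprime : ∀ {n x} .{{_ : NonZero n}} → Coprime x n →
                      ∀ {a b} → a < n → b < n → (a * x) % n ≡ (b * x) % n → a ≡ b
*-cancelʳ-%-coprime {n} {x} x⊥n {a} {b} a<n b<n eq =
  ≤-antisym (m∸n≡0⇒m≤n (∸≡0 {b = b} a<n eq)) (m∸n≡0⇒m≤n (∸≡0 {b = a} b<n (sym eq)))
  where
  ∸≡0 : ∀ {a b} → a < n → (a * x) % n ≡ (b * x) % n → a ∸ b ≡ 0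
  ∸≡0 {a} {b} a<n eq = ∣∧<⇒≡0 (coprime-divisor (Coprimality.sym x⊥n) n∣x*[a∸b]) (≤-<-trans (m∸n≤m a b) a<n)
    where
    n∣x*[a∸b] : n ∣ x * (a ∸ b)
    n∣x*[a∸b] = subst (n ∣_) (trans (sym (*-distribʳ-∸ x a b)) (*-comm (a ∸ b) x)) (%-≡⇒∣∸ (a * x) (b * x) n eq)

%-*-cancelʳ : ∀ a b n g .{{_ : NonZero n}} .{{_ : NonZero g}} .{{_ : NonZero (n * g)}} →
              (a * g) % (n * g) ≡ (b * g) % (n * g) → a % n ≡ b % n
%-*-cancelʳ a b n g eq = *-cancelʳ-≡ _ _ g (begin
  a % n * g         ≡⟨ m%n*o≡m*o%[n*o] a n g ⟩
  (a * g) % (n * g) ≡⟨ eq ⟩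
  (b * g) % (n * g) ≡⟨ sym (m%n*o≡m*o%[n*o] b n g) ⟩
  b % n * g         ∎)

%-*-congʳ : ∀ a b n g .{{_ : NonZero n}} .{{_ : NonZero (n * g)}} →
            a % n ≡ b % n → (a * g) % (n * g) ≡ (b * g) % (n * g)
%-*-congʳ a b n g eq = begin
  (a * g) % (n * g) ≡⟨ sym (m%n*o≡m*o%[n*o] a n g) ⟩
  a % n * g         ≡⟨ cong (_* g) eq ⟩
  b % n * g         ≡⟨ m%n*o≡m*o%[n*o] b n g ⟩
  (b * g) % (n * g) ∎

solutions : (n : ℕ) .{{_ : NonZero n}} → ℕ → ℕ → ℕ
solutions n x y = ∑ n (λ t → 𝟙 ((t * x) % n ≟ y % n))

solutions-cong : ∀ {n n' x x' y y'} .{{_ : NonZero n}} .{{_ : NonZero n'}} →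
                 n ≡ n' → x ≡ x' → y ≡ y' → solutions n x y ≡ solutions n' x' y'
solutions-cong refl refl refl = refl

solutions-coprime : ∀ {n x} .{{_ : NonZero n}} → Coprime x n → ∀ y → solutions n x y ≡ 1
solutions-coprime {n} {x} x⊥n y = ∑-𝟙-injective n (λ t → (t * x) % n) (λ t _ → m%n<n (t * x) n)
  (λ a b a<n b<n → *-cancelʳ-%-coprime x⊥n a<n b<n) (y % n) (m%n<n y n)

solutions-* : ∀ n g x y .{{_ : NonZero n}} .{{_ : NonZero g}} .{{_ : NonZero (n * g)}} →
              solutions (n * g) (x * g) (y * g) ≡ g * solutions n x y
solutions-* n g x y = begin
  solutions (n * g) (x * g) (y * g)
    ≡⟨ ∑-cong (n * g) (λ t _ → 𝟙-cong _ _ (descend t) (ascend t)) ⟩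
  ∑ (n * g) (λ t → 𝟙 ((t * x) % n ≟ y % n))
    ≡⟨ ∑-blocks n g _ ⟩
  ∑ g (λ a → ∑ n (λ r → 𝟙 (((r + n * a) * x) % n ≟ y % n)))
    ≡⟨ ∑-cong g (λ a _ → ∑-cong n (λ r _ → cong (λ z → 𝟙 (z ≟ y % n)) (periodic r a))) ⟩
  ∑ g (λ _ → solutions n x y)
    ≡⟨ ∑-const g _ ⟩
  g * solutions n x y ∎
  where
  descend : ∀ t → (t * (x * g)) % (n * g) ≡ (y * g) % (n * g) → (t * x) % n ≡ y % n
  descend t eq = %-*-cancelʳ (t * x) y n g (trans (cong (_% (n * g)) (*-assoc t x g)) eq)
  ascend : ∀ t → (t * x) % n ≡ y % n → (t * (x * g)) % (n * g) ≡ (y * g) % (n * g)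
  ascend t eq = trans (cong (_% (n * g)) (sym (*-assoc t x g))) (%-*-congʳ (t * x) y n g eq)
  periodic : ∀ r a → ((r + n * a) * x) % n ≡ (r * x) % n
  periodic r a = trans (cong (_% n) (expand r a n x)) ([m+kn]%n≡m%n (r * x) (a * x) n)
    where
    expand : ∀ r a k u → (r + k * a) * u ≡ r * u + a * u * k
    expand = solve-∀

gcd[m,n]-nonZero : ∀ m n .{{_ : NonZero n}} → NonZero (gcd m n)
gcd[m,n]-nonZero m n = ≢-nonZero (gcd[m,n]≢0 m n (inj₂ (≢-nonZero⁻¹ n)))

solutions-∤ : ∀ n x y .{{_ : NonZero n}} → ¬ (gcd x n ∣ y) → solutions n x y ≡ 0
solutions-∤ n x y g∤y = ∑-zero n (λ t _ → 𝟙-no _ (λ eq → g∤y (∣n∣m%n⇒∣m g∣n (subst (g ∣_) eq (g∣tx%n t)))))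
  where
  g : ℕ
  g = gcd x n
  g∣n : g ∣ n
  g∣n = gcd[m,n]∣n x n
  g∣tx%n : ∀ t → g ∣ (t * x) % n
  g∣tx%n t = %-presˡ-∣ (∣n⇒∣m*n t (gcd[m,n]∣m x n)) g∣n

solutions-∣ : ∀ n x y .{{_ : NonZero n}} → gcd x n ∣ y → solutions n x y ≡ gcd x n
solutions-∣ n x y g∣y = begin
  solutions n x y                      ≡⟨ solutions-cong (scaled (gcd[m,n]∣n x n)) (scaled (gcd[m,n]∣m x n)) (scaled g∣y) ⟩
  solutions (n' * g) (x' * g) (y' * g) ≡⟨ solutions-* n' g x' y' ⟩
  g * solutions n' x' y'               ≡⟨ cong (g *_) (solutions-coprime (coprime-/gcd x n) y') ⟩
  g * 1                                ≡⟨ *-identityʳ g ⟩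
  g                                    ∎
  where
  g : ℕ
  g = gcd x n
  instance
    g-nonZero : NonZero g
    g-nonZero = gcd[m,n]-nonZero x n
  n' x' y' : ℕ
  n' = n / g
  x' = x / g
  y' = y / g
  scaled : ∀ {z} → g ∣ z → z ≡ z / g * g
  scaled g∣z = sym (m/n*n≡m g∣z)
  instance
    n'-nonZero : NonZero n'
    n'-nonZero = ≢-nonZero (n/gcd[m,n]≢0 x n)
    n'g-nonZero : NonZero (n' * g)
    n'g-nonZero = m*n≢0 n' g

solutions-gcd : ∀ n x y .{{_ : NonZero n}} → solutions n x y ≡ gcd x n * 𝟙 (gcd x n ∣? y)
solutions-gcd n x y with gcd x n ∣? y
... | yes g∣y = trans (solutions-∣ n x y g∣y) (sym (*-identityʳ (gcd x n)))
... | no g∤y  = trans (solutions-∤ n x y g∤y) (sym (*-zeroʳ (gcd x n)))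

m*[n%o]%o≡m*n%o : ∀ m n o .{{_ : NonZero o}} → (m * (n % o)) % o ≡ (m * n) % o
m*[n%o]%o≡m*n%o m n o = begin
  (m * (n % o)) % o            ≡⟨ %-distribˡ-* m (n % o) o ⟩
  ((m % o) * (n % o % o)) % o  ≡⟨ cong (λ r → ((m % o) * r) % o) (m%n%n≡m%n n o) ⟩
  ((m % o) * (n % o)) % o      ≡⟨ sym (%-distribˡ-* m n o) ⟩
  (m * n) % o                  ∎

solutions-%ˡ : ∀ n x y .{{_ : NonZero n}} → solutions n (x % n) y ≡ solutions n x y
solutions-%ˡ n x y = ∑-cong n (λ t _ → cong (λ r → 𝟙 (r ≟ y % n)) (m*[n%o]%o≡m*n%o t x n))

solutions-rotate : ∀ n x y .{{_ : NonZero n}} → ∑ n (λ t → 𝟙 ((suc t * x) % n ≟ y % n)) ≡ solutions n x y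
solutions-rotate n x y = ∑-rotate n (λ t → 𝟙 ((t * x) % n ≟ y % n))
  (cong (λ r → 𝟙 (r ≟ y % n)) (trans (cong (_% n) (*-comm n x)) ([m+kn]%n≡m%n 0 x n)))

φ≡∑ : ∀ n → φ n ≡ ∑ n (λ a → 𝟙 (gcd a n ≟ 1))
φ≡∑ n = begin
  φ n                                        ≡⟨ length-filter _ (map suc (upTo n)) ⟩
  sum (map _ (map suc (upTo n)))             ≡⟨ sum-map-map suc (upTo n) _ ⟩
  sum (map _ (upTo n))                       ≡⟨ sum-map-applyUpTo (λ a → a) n _ ⟩
  ∑ n (λ a → 𝟙 (gcd (suc a) n ≟ 1))          ≡⟨ ∑-rotate n (λ a → 𝟙 (gcd a n ≟ 1)) (cong (λ g → 𝟙 (g ≟ 1)) gcd[n,n]≡gcd[0,n]) ⟩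
  ∑ n (λ a → 𝟙 (gcd a n ≟ 1))                ∎
  where
  gcd[n,n]≡gcd[0,n] : gcd n n ≡ gcd 0 n
  gcd[n,n]≡gcd[0,n] = trans (GCD.unique (gcd-GCD n n) GCD.refl) (sym (gcd-identityˡ n))

∑-gcd≡φ : ∀ n l .{{_ : NonZero n}} .{{_ : NonZero l}} → l ∣ n → ∑ n (λ c → 𝟙 (gcd c n ≟ l)) ≡ φ (n / l)
∑-gcd≡φ n l@(suc j) l∣n = begin
  ∑ n (λ c → 𝟙 (gcd c n ≟ l))                          ≡⟨ cong (λ k → ∑ k (λ c → 𝟙 (gcd c n ≟ l))) (sym (m*[n/m]≡n l∣n)) ⟩
  ∑ (l * n') (λ c → 𝟙 (gcd c n ≟ l))                   ≡⟨ ∑-blocks l n' _ ⟩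
  ∑ n' (λ a → ∑ l (λ r → 𝟙 (gcd (r + l * a) n ≟ l)))   ≡⟨ ∑-cong n' (λ a _ → block a) ⟩
  ∑ n' (λ a → 𝟙 (gcd a n' ≟ 1))                        ≡⟨ sym (φ≡∑ n') ⟩
  φ n'                                                 ∎
  where
  n' : ℕ
  n' = n / l
  gcd[la,n]≡l*gcd[a,n'] : ∀ a → gcd (l * a) n ≡ l * gcd a n'
  gcd[la,n]≡l*gcd[a,n'] a = trans (cong (gcd (l * a)) (sym (m*[n/m]≡n l∣n))) (sym (c*gcd[m,n]≡gcd[cm,cn] l a n'))
  l∤ : ∀ r a → r < j → gcd (suc r + l * a) n ≢ l
  l∤ r a r<j gcd≡l = >⇒∤ (s<s r<j) (∣m+n∣m⇒∣n l∣la+[1+r] (m∣m*n a))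
    where
    l∣la+[1+r] : l ∣ l * a + suc r
    l∣la+[1+r] = subst₂ _∣_ gcd≡l (+-comm (suc r) (l * a)) (gcd[m,n]∣m (suc r + l * a) n)
  block : ∀ a → ∑ l (λ r → 𝟙 (gcd (r + l * a) n ≟ l)) ≡ 𝟙 (gcd a n' ≟ 1)
  block a = begin
    𝟙 (gcd (l * a) n ≟ l) + ∑ j (λ r → 𝟙 (gcd (suc r + l * a) n ≟ l))
      ≡⟨ cong (𝟙 (gcd (l * a) n ≟ l) +_) (∑-zero j (λ r r<j → 𝟙-no _ (l∤ r a r<j))) ⟩
    𝟙 (gcd (l * a) n ≟ l) + 0              ≡⟨ +-identityʳ _ ⟩
    𝟙 (gcd (l * a) n ≟ l)                  ≡⟨ cong (λ g → 𝟙 (g ≟ l)) (gcd[la,n]≡l*gcd[a,n'] a) ⟩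
    𝟙 (l * gcd a n' ≟ l)                   ≡⟨ 𝟙-cong _ _ (λ e → *-cancelˡ-≡ _ _ l (trans e (sym (*-identityʳ l))))
                                                          (λ e → trans (cong (l *_) e) (*-identityʳ l)) ⟩
    𝟙 (gcd a n' ≟ 1)                       ∎

∑-solutions-∘ : ∀ n d y .{{_ : NonZero n}} →
                ∑ n (λ t → solutions n (suc t * d) y) ≡ ∑ n (λ c → solutions n d c * solutions n c y)
∑-solutions-∘ n d y = begin
  ∑ n (λ t → solutions n (suc t * d) y)          ≡⟨ ∑-rotate n (λ t → solutions n (t * d) y) solutions[nd]≡solutions[0] ⟩
  ∑ n (λ t → solutions n (t * d) y)              ≡⟨ ∑-cong n (λ t _ → sym (solutions-%ˡ n (t * d) y)) ⟩
  ∑ n (λ t → solutions n ((t * d) % n) y)        ≡⟨ ∑-fibers n n (λ t → (t * d) % n) (λ c → solutions n c y) (λ t _ → m%n<n (t * d) n) ⟩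
  ∑ n (λ c → ∑ n (λ t → 𝟙 ((t * d) % n ≟ c)) * solutions n c y)
    ≡⟨ ∑-cong n (λ c c<n → cong (λ r → ∑ n (λ t → 𝟙 ((t * d) % n ≟ r)) * solutions n c y) (sym (m<n⇒m%n≡m c<n))) ⟩
  ∑ n (λ c → solutions n d c * solutions n c y)  ∎
  where
  solutions[nd]≡solutions[0] : solutions n (n * d) y ≡ solutions n 0 y
  solutions[nd]≡solutions[0] = trans (sym (solutions-%ˡ n (n * d) y)) (cong (λ r → solutions n r y) (trans (cong (_% n) (*-comm n d)) (m*n%n≡0 d n)))

∑-solutions-solutions : ∀ n d y .{{_ : NonZero n}} .{{_ : NonZero y}} → y ∣ n →
  ∑ n (λ c → solutions n d c * solutions n c y) ≡ ∑ y (λ j → 𝟙 (suc j ∣? y) * (suc j * φ (n / suc j) * solutions n d (suc j)))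
∑-solutions-solutions n d y y∣n = begin
  ∑ n (λ c → solutions n d c * solutions n c y)     ≡⟨ ∑-cong n (λ c _ → summand c) ⟩
  ∑ n (λ c → weight (gcd c n))                      ≡⟨ ∑-fibers n (suc n) (λ c → gcd c n) weight (λ c _ → s≤s (gcd[m,n]≤n c n)) ⟩
  count 0 * weight 0 + ∑ n (λ j → count (suc j) * weight (suc j))
    ≡⟨ cong (_+ ∑ n (λ j → count (suc j) * weight (suc j))) (vanish (count 0) (solutions n d 0) 0) ⟩
  ∑ n (λ j → count (suc j) * weight (suc j))        ≡⟨ ∑-truncate _ (∣⇒≤ y∣n) (λ j y≤j _ → beyond j y≤j) ⟩
  ∑ y (λ j → count (suc j) * weight (suc j))        ≡⟨ ∑-cong y (λ j _ → divisor-term j) ⟩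
  ∑ y (λ j → 𝟙 (suc j ∣? y) * (suc j * φ (n / suc j) * solutions n d (suc j))) ∎
  where
  count : ℕ → ℕ
  count l = ∑ n (λ c → 𝟙 (gcd c n ≟ l))
  weight : ℕ → ℕ
  weight l = solutions n d l * (l * 𝟙 (l ∣? y))
  summand : ∀ c → solutions n d c * solutions n c y ≡ weight (gcd c n)
  summand c = cong₂ _*_ (begin
    solutions n d c                          ≡⟨ solutions-gcd n d c ⟩
    gcd d n * 𝟙 (gcd d n ∣? c)               ≡⟨ cong (gcd d n *_) (𝟙-cong _ _ (λ g∣c → gcd-greatest g∣c (gcd[m,n]∣n d n))
                                                                        (λ g∣gcd → ∣-trans g∣gcd (gcd[m,n]∣m c n))) ⟩
    gcd d n * 𝟙 (gcd d n ∣? gcd c n)         ≡⟨ sym (solutions-gcd n d (gcd c n)) ⟩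
    solutions n d (gcd c n)                  ∎) (solutions-gcd n c y)
  vanish : ∀ a b l → a * (b * (l * 0)) ≡ 0
  vanish = solve-∀
  beyond : ∀ j → y ≤ j → count (suc j) * weight (suc j) ≡ 0
  beyond j y≤j = trans (cong (λ i → count (suc j) * (solutions n d (suc j) * (suc j * i))) (𝟙-no _ (>⇒∤ (s≤s y≤j))))
                       (vanish (count (suc j)) (solutions n d (suc j)) (suc j))
  divisor-term : ∀ j → count (suc j) * weight (suc j) ≡ 𝟙 (suc j ∣? y) * (suc j * φ (n / suc j) * solutions n d (suc j))
  divisor-term j with suc j ∣? y
  ... | yes l∣y = trans (cong (_* weight′) (∑-gcd≡φ n (suc j) (∣-trans l∣y y∣n))) (rearrange (φ (n / suc j)) (solutions n d (suc j)) (suc j))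
    where
    weight′ : ℕ
    weight′ = solutions n d (suc j) * (suc j * 1)
    rearrange : ∀ a b l → a * (b * (l * 1)) ≡ 1 * (l * a * b)
    rearrange = solve-∀
  ... | no _    = vanish (count (suc j)) (solutions n d (suc j)) (suc j)

sumDivisors≡∑ : ∀ i (f : (l : ℕ) → .{{NonZero l}} → ℕ) → sumDivisors i f ≡ ∑ i (λ j → 𝟙 (suc j ∣? i) * f (suc j))
sumDivisors≡∑ i f = trans (sum-map-filter (λ j → suc j ∣? i) (upTo i) _) (sum-map-applyUpTo (λ j → j) i _)

-- Partitions into powers of m

module Partitions (m : ℕ) .{{_ : NonZero m}} where

  -- The first coordinate is x₁ = n ∸ m j, where j = x₂ + m x₃ + ⋯.
  p : ℕ → ℕ → ℕ
  p zero    n = 𝟙 (n ≟ 0)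
  p (suc k) n = ∑ (suc n) (λ j → 𝟙 (m * j ≤? n) * p k j)

  p≤ : ℕ → ℕ → ℕ
  p≤ k q = ∑ (suc q) (p k)

  j≤m*j : ∀ j → j ≤ m * j
  j≤m*j j = m≤n*m j m

  p-suc-≤ : ∀ k {n B} → n ≤ B → ∑ (suc B) (λ j → 𝟙 (m * j ≤? n) * p k j) ≡ p (suc k) n
  p-suc-≤ k n≤B = ∑-truncate _ (s≤s n≤B)
    (λ j n<j _ → cong (_* p k j) (𝟙-no (m * _ ≤? _) (λ mj≤n → <⇒≱ n<j (≤-trans (j≤m*j j) mj≤n))))

  sum-tuples-suc : ∀ k B (f : ℕ → ℕ) → sum (map (λ v → f (weighted m v)) (tuples (suc k) B))
                             ≡ ∑ (suc B) (λ x → sum (map (λ v → f (x + m * weighted m v)) (tuples k B)))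
  sum-tuples-suc k B f = begin
    sum (map h (tuples (suc k) B))
      ≡⟨ sum-map-concatMap (λ x → map (x ∷ᵛ_) (tuples k B)) (upTo (suc B)) h ⟩
    sum (map (λ x → sum (map h (map (x ∷ᵛ_) (tuples k B)))) (upTo (suc B)))
      ≡⟨ sum-map-cong (upTo (suc B)) (λ x → sum-map-map (x ∷ᵛ_) (tuples k B) h) ⟩
    sum (map (λ x → sum (map (h ∘ (x ∷ᵛ_)) (tuples k B))) (upTo (suc B)))     ≡⟨ sum-map-applyUpTo (λ x → x) (suc B) _ ⟩
    ∑ (suc B) (λ x → sum (map (λ v → f (x + m * weighted m v)) (tuples k B))) ∎
    where
    h : Vec ℕ (suc k) → ℕ
    h v = f (weighted m v)

  ∑-tuples : ∀ k B (f : ℕ → ℕ) → (∀ j → B < j → f j ≡ 0) →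
             sum (map (λ v → f (weighted m v)) (tuples k B)) ≡ ∑ (suc B) (λ j → p k j * f j)
  ∑-tuples zero    B f _      = sym (trans (cong (f 0 + 0 +_) (∑-zero B (λ _ _ → refl))) (+-identityʳ _))
  ∑-tuples (suc k) B f vanish = begin
    sum (map (λ v → f (weighted m v)) (tuples (suc k) B))
      ≡⟨ sum-tuples-suc k B f ⟩
    ∑ (suc B) (λ x → sum (map (λ v → f (x + m * weighted m v)) (tuples k B)))
      ≡⟨ ∑-cong (suc B) (λ x _ → ∑-tuples k B (λ j → f (x + m * j)) (λ j B<j → vanish _ (<-≤-trans B<j (j≤x+m*j x j)))) ⟩
    ∑ (suc B) (λ x → ∑ (suc B) (λ j → p k j * f (x + m * j)))
      ≡⟨ ∑-comm (suc B) (suc B) (λ x j → p k j * f (x + m * j)) ⟩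
    ∑ (suc B) (λ j → ∑ (suc B) (λ x → p k j * f (x + m * j)))
      ≡⟨ ∑-cong (suc B) (λ j _ → trans (∑-*ˡ (suc B) (p k j) (λ x → f (x + m * j))) (cong (p k j *_) (∑-shift (suc B) (m * j) f vanish))) ⟩
    ∑ (suc B) (λ j → p k j * ∑ (suc B) (λ n → 𝟙 (m * j ≤? n) * f n))
      ≡⟨ ∑-*-∑-comm (suc B) (suc B) (p k) (λ j n → 𝟙 (m * j ≤? n)) f ⟩
    ∑ (suc B) (λ n → ∑ (suc B) (λ j → 𝟙 (m * j ≤? n) * p k j) * f n)
      ≡⟨ ∑-cong (suc B) (λ n n≤B → cong (_* f n) (p-suc-≤ k (s≤s⁻¹ n≤B))) ⟩
    ∑ (suc B) (λ n → p (suc k) n * f n) ∎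
    where
    j≤x+m*j : ∀ x j → j ≤ x + m * j
    j≤x+m*j x j = ≤-trans (j≤m*j j) (m≤n+m (m * j) x)

  pM≡p : ∀ n k → pM m n k ≡ p k n
  pM≡p n k = begin
    pM m n k                                      ≡⟨ length-filter _ (tuples k n) ⟩
    sum (map (λ v → 𝟙 (weighted m v ≟ n)) (tuples k n))
      ≡⟨ ∑-tuples k n (λ j → 𝟙 (j ≟ n)) (λ j n<j → 𝟙-no (j ≟ n) (>⇒≢ n<j)) ⟩
    ∑ (suc n) (λ j → p k j * 𝟙 (j ≟ n))
      ≡⟨ ∑-cong (suc n) (λ j _ → trans (*-comm (p k j) (𝟙 (j ≟ n))) (cong (_* p k j) (𝟙-≟-sym j n))) ⟩
    ∑ (suc n) (λ j → 𝟙 (n ≟ j) * p k j)           ≡⟨ ∑-pick (suc n) n (p k) ≤-refl ⟩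
    p k n                                         ∎

  p-suc-+ : ∀ k t q → t < m → p (suc k) (t + m * q) ≡ p≤ k q
  p-suc-+ k t q t<m = begin
    p (suc k) (t + m * q)
      ≡⟨ ∑-truncate _ (s≤s q≤t+mq) (λ j q<j _ → cong (_* p k j) (𝟙-no (m * j ≤? _) (<⇒≱ (t+mq<mj j q<j)))) ⟩
    ∑ (suc q) (λ j → 𝟙 (m * j ≤? t + m * q) * p k j)
      ≡⟨ ∑-cong (suc q) (λ j j≤q → trans (cong (_* p k j) (𝟙-yes (m * j ≤? _) (mj≤t+mq j (s≤s⁻¹ j≤q)))) (+-identityʳ _)) ⟩
    p≤ k q                                              ∎
    where
    q≤t+mq : q ≤ t + m * q
    q≤t+mq = ≤-trans (j≤m*j q) (m≤n+m (m * q) t)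
    mj≤t+mq : ∀ j → j ≤ q → m * j ≤ t + m * q
    mj≤t+mq j j≤q = ≤-trans (*-monoʳ-≤ m j≤q) (m≤n+m (m * q) t)
    t+mq<mj : ∀ j → q < j → t + m * q < m * j
    t+mq<mj j q<j = <-≤-trans (+-monoˡ-< (m * q) t<m) (subst (_≤ m * j) (*-suc m q) (*-monoʳ-≤ m q<j))

  p≤-suc : ∀ k s b → s < m → p≤ (suc k) (s + m * b) ≡ suc s * p≤ k b + ∑ b (p≤ k) * m
  p≤-suc k s b s<m = begin
    ∑ (suc (s + m * b)) (p (suc k))
      ≡⟨ cong (λ n → ∑ n (p (suc k))) (trans (cong suc (+-comm s (m * b))) (sym (+-suc (m * b) s))) ⟩
    ∑ (m * b + suc s) (p (suc k))                                        ≡⟨ ∑-split (m * b) (suc s) (p (suc k)) ⟩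
    ∑ (m * b) (p (suc k)) + ∑ (suc s) (λ t → p (suc k) (m * b + t))     ≡⟨ +-comm (∑ (m * b) (p (suc k))) _ ⟩
    ∑ (suc s) (λ t → p (suc k) (m * b + t)) + ∑ (m * b) (p (suc k))     ≡⟨ cong₂ _+_ last-block full-blocks ⟩
    suc s * p≤ k b + ∑ b (p≤ k) * m                                      ∎
    where
    last-block : ∑ (suc s) (λ t → p (suc k) (m * b + t)) ≡ suc s * p≤ k b
    last-block = trans (∑-cong (suc s) (λ t t≤s → trans (cong (p (suc k)) (+-comm (m * b) t)) (p-suc-+ k t b (<-≤-trans t≤s s<m))))
                       (∑-const (suc s) (p≤ k b))
    full-blocks : ∑ (m * b) (p (suc k)) ≡ ∑ b (p≤ k) * m
    full-blocks = begin
      ∑ (m * b) (p (suc k))                               ≡⟨ ∑-blocks m b (p (suc k)) ⟩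
      ∑ b (λ a → ∑ m (λ t → p (suc k) (t + m * a)))
        ≡⟨ ∑-cong b (λ a _ → trans (∑-cong m (λ t t<m → p-suc-+ k t a t<m)) (∑-const m (p≤ k a))) ⟩
      ∑ b (λ a → m * p≤ k a)                              ≡⟨ ∑-*ˡ b m (p≤ k) ⟩
      m * ∑ b (p≤ k)                                      ≡⟨ *-comm m _ ⟩
      ∑ b (p≤ k) * m                                      ∎

  p≤-suc-% : ∀ k s b → s < m → p≤ (suc k) (s + m * b) % m ≡ (suc s * p≤ k b) % m
  p≤-suc-% k s b s<m = trans (cong (_% m) (p≤-suc k s b s<m)) ([m+kn]%n≡m%n (suc s * p≤ k b) (∑ b (p≤ k)) m)

  ∑-p-suc : ∀ k (h : ℕ → ℕ) → ∑ (m ^ suc k) (λ n → h (p (suc k) n)) ≡ m * ∑ (m ^ k) (λ q → h (p≤ k q))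
  ∑-p-suc k h = begin
    ∑ (m * m ^ k) (λ n → h (p (suc k) n))                   ≡⟨ ∑-blocks m (m ^ k) _ ⟩
    ∑ (m ^ k) (λ q → ∑ m (λ t → h (p (suc k) (t + m * q))))
      ≡⟨ ∑-cong (m ^ k) (λ q _ → trans (∑-cong m (λ t t<m → cong h (p-suc-+ k t q t<m))) (∑-const m _)) ⟩
    ∑ (m ^ k) (λ q → m * h (p≤ k q))                        ≡⟨ ∑-*ˡ (m ^ k) m _ ⟩
    m * ∑ (m ^ k) (λ q → h (p≤ k q))                        ∎

  ∑-p≤-suc : ∀ k (h : ℕ → ℕ) → (∀ x → h (x % m) ≡ h x) →
             ∑ (m ^ suc k) (λ a → h (p≤ (suc k) a)) ≡ ∑ (m ^ k) (λ q → ∑ m (λ s → h (suc s * p≤ k q)))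
  ∑-p≤-suc k h periodic = begin
    ∑ (m * m ^ k) (λ a → h (p≤ (suc k) a))                  ≡⟨ ∑-blocks m (m ^ k) _ ⟩
    ∑ (m ^ k) (λ q → ∑ m (λ s → h (p≤ (suc k) (s + m * q)))) ≡⟨ ∑-cong (m ^ k) (λ q _ → ∑-cong m (λ s s<m → reduce s q s<m)) ⟩
    ∑ (m ^ k) (λ q → ∑ m (λ s → h (suc s * p≤ k q)))         ∎
    where
    reduce : ∀ s q → s < m → h (p≤ (suc k) (s + m * q)) ≡ h (suc s * p≤ k q)
    reduce s q s<m = begin
      h (p≤ (suc k) (s + m * q))      ≡⟨ sym (periodic _) ⟩
      h (p≤ (suc k) (s + m * q) % m)  ≡⟨ cong h (p≤-suc-% k s q s<m) ⟩
      h ((suc s * p≤ k q) % m)        ≡⟨ periodic _ ⟩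
      h (suc s * p≤ k q)              ∎

  rM≡∑ : ∀ i k → rM i m k ≡ ∑ (m ^ k) (λ n → 𝟙 (p k n % m ≟ i % m))
  rM≡∑ i k = begin
    rM i m k                                   ≡⟨ length-filter _ (upTo (m ^ k)) ⟩
    sum (map _ (upTo (m ^ k)))                 ≡⟨ sum-map-applyUpTo (λ n → n) (m ^ k) _ ⟩
    ∑ (m ^ k) (λ n → 𝟙 (pM m n k % m ≟ i % m)) ≡⟨ ∑-cong (m ^ k) (λ n _ → cong (λ r → 𝟙 (r % m ≟ i % m)) (pM≡p n k)) ⟩
    ∑ (m ^ k) (λ n → 𝟙 (p k n % m ≟ i % m))    ∎

  rM-2+ : ∀ K i → rM i m (2 + K) ≡ m * ∑ (m ^ K) (λ q → solutions m (p≤ K q) i)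
  rM-2+ K i = begin
    rM i m (2 + K)                                             ≡⟨ rM≡∑ i (2 + K) ⟩
    ∑ (m ^ (2 + K)) (λ n → ≡i (p (2 + K) n))                  ≡⟨ ∑-p-suc (suc K) ≡i ⟩
    m * ∑ (m ^ suc K) (λ a → ≡i (p≤ (suc K) a))
      ≡⟨ cong (m *_) (∑-p≤-suc K ≡i (λ x → cong (λ r → 𝟙 (r ≟ i % m)) (m%n%n≡m%n x m))) ⟩
    m * ∑ (m ^ K) (λ q → ∑ m (λ s → ≡i (suc s * p≤ K q)))     ≡⟨ cong (m *_) (∑-cong (m ^ K) (λ q _ → solutions-rotate m (p≤ K q) i)) ⟩
    m * ∑ (m ^ K) (λ q → solutions m (p≤ K q) i)               ∎
    where
    ≡i : ℕ → ℕ
    ≡i x = 𝟙 (x % m ≟ i % m)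

corollary6p12 : (k m i : ℕ) → .{{_ : NonZero m}} → 2 < k → 1 < m → 0 < i → i ∣ m →
    rM i m k ≡ sumDivisors i (λ l → l * φ (m / l) * rM l m (k ∸ 1))
corollary6p12 (suc (suc (suc K))) m i (s≤s (s≤s (s≤s _))) _ 0<i i∣m = begin
  rM i m (3 + K)
    ≡⟨ rM-2+ (suc K) i ⟩
  m * ∑ (m ^ suc K) (λ b → solutions m (p≤ (suc K) b) i)
    ≡⟨ cong (m *_) (∑-p≤-suc K (λ x → solutions m x i) (λ x → solutions-%ˡ m x i)) ⟩
  m * ∑ (m ^ K) (λ q → ∑ m (λ t → solutions m (suc t * p≤ K q) i))
    ≡⟨ cong (m *_) (∑-cong (m ^ K) (λ q _ → trans (∑-solutions-∘ m (p≤ K q) i) (∑-solutions-solutions m (p≤ K q) i i∣m))) ⟩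
  m * ∑ (m ^ K) (λ q → ∑ i (λ j → 𝟙 (suc j ∣? i) * (suc j * φ (m / suc j) * solutions m (p≤ K q) (suc j))))
    ≡⟨ *-∑-∑-comm m (m ^ K) i (λ j → 𝟙 (suc j ∣? i)) (λ j → suc j * φ (m / suc j)) (λ q j → solutions m (p≤ K q) (suc j)) ⟩
  ∑ i (λ j → 𝟙 (suc j ∣? i) * (suc j * φ (m / suc j) * (m * ∑ (m ^ K) (λ q → solutions m (p≤ K q) (suc j)))))
    ≡⟨ ∑-cong i (λ j _ → cong (λ r → 𝟙 (suc j ∣? i) * (suc j * φ (m / suc j) * r)) (sym (rM-2+ K (suc j)))) ⟩
  ∑ i (λ j → 𝟙 (suc j ∣? i) * (suc j * φ (m / suc j) * rM (suc j) m (2 + K)))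
    ≡⟨ sym (sumDivisors≡∑ i (λ l → l * φ (m / l) * rM l m (2 + K))) ⟩
  sumDivisors i (λ l → l * φ (m / l) * rM l m (2 + K)) ∎
  where
  open Partitions m
  instance
    i-nonZero : NonZero i
    i-nonZero = >-nonZero 0<i
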